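{- Call a finite digraph $D$ on $n$ vertices good if $D$ has a quasi-kernel $K$ with $|K|\le \frac{n+|S|-|N_D^+(S)|}{2}$, where $S$ is the set of sources of $D$ (vertices of indegree $0$) and $N_D^+(S)=\bigl(\bigcup_{x\in S}N_D^+(x)\bigr)\setminus S$. If there exists a digraph that is not good, and $D$ is a digraph that is not good with the minimum number of vertices among all digraphs that are not good, then $D$ has no source.
   Context: Digraphs are finite, have no loops, and may contain antiparallel arcs. For a vertex $x$, $N_D^+(x)=\{y: xy\in A(D)\}$. A set $K\subseteq V(D)$ is independent if no arc of $D$ joins two vertices of $K$. The distance ${\rm dist}_D(u,v)$ is the length of a shortest directed path from $u$ to $v$, and ${\rm dist}_D(K,v)=\min_{x\in K}{\rm dist}_D(x,v)$. A quasi-kernel of $D$ is an independent set $K$ with ${\rm dist}_D(K,v)\le 2$ for every $v\in V(D)\setminus K$. -}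

module Defs where

open import Data.Nat using (ℕ; _+_; _*_; _≤_)
open import Data.Bool using (Bool; true; false; _∧_; not)
open import Data.Bool.Properties using () renaming (_≟_ to _≟ᵇ_)
open import Data.Fin using (Fin)
open import Data.Fin.Subset using (Subset; _∈_; _∉_; ∣_∣)
open import Data.Fin.Properties using (all?; any?)
open import Data.Vec using (tabulate)
open import Data.Product using (Σ; ∃; _×_; _,_)
open import Data.Sum using (_⊎_)
open import Relation.Nullary using (¬_)
open import Relation.Nullary.Decidable using (⌊_⌋)
open import Relation.Binary.PropositionalEquality using (_≡_)

-- A finite digraph on the vertex set Fin n: arcs given by a Boolean
-- adjacency relation, no loops; antiparallel arcs are allowed.
record Digraph (n : ℕ) : Set where
  field
    arc      : Fin n → Fin n → Bool
    loopless : ∀ x → arc x x ≡ false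
open Digraph public

Arc : ∀ {n} → Digraph n → Fin n → Fin n → Set
Arc D x y = arc D x y ≡ true

Independent : ∀ {n} → Digraph n → Subset n → Set
Independent D K = ∀ x y → x ∈ K → y ∈ K → ¬ Arc D x y

DistAtMost2 : ∀ {n} → Digraph n → Subset n → Fin n → Set
DistAtMost2 D K v =
  ∃ λ x → x ∈ K × (Arc D x v ⊎ ∃ λ y → Arc D x y × Arc D y v)

IsQuasiKernel : ∀ {n} → Digraph n → Subset n → Set
IsQuasiKernel D K = Independent D K × (∀ v → v ∉ K → DistAtMost2 D K v)

IsSource : ∀ {n} → Digraph n → Fin n → Set
IsSource D x = ∀ y → arc D y x ≡ false

sources : ∀ {n} → Digraph n → Subset n
sources D = tabulate λ x → ⌊ all? (λ y → arc D y x ≟ᵇ false) ⌋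

-- N⁺_D(S) = (⋃_{x ∈ S} N⁺(x)) \ S
outNbhdSources : ∀ {n} → Digraph n → Subset n
outNbhdSources D = tabulate λ y →
  not (⌊ all? (λ z → arc D z y ≟ᵇ false) ⌋)
  ∧ ⌊ any? (λ x → (⌊ all? (λ z → arc D z x ≟ᵇ false) ⌋ ∧ arc D x y) ≟ᵇ true) ⌋

-- D is good: it has a quasi-kernel K with |K| ≤ (n + |S| - |N⁺(S)|)/2,
-- written without division/subtraction as 2|K| + |N⁺(S)| ≤ n + |S|.
Good : ∀ {n} → Digraph n → Set
Good {n} D = ∃ λ K → IsQuasiKernel D K ×
  (2 * ∣ K ∣ + ∣ outNbhdSources D ∣ ≤ n + ∣ sources D ∣)

module Submission where

-- Write S for the sources of D and N for N⁺(S).  Suppose D is a minimal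
-- digraph that is not good and x is a source, so S ≠ ∅.  The argument
-- rests on an extension lemma: if P ⊆ V avoids N and every vertex outside
-- S ∪ N ∪ P is within distance 2 of S ("P is admissible"), then S together
-- with any quasi-kernel K of D[P] is a quasi-kernel of D, of size at most
-- |S| + |K|; hence D is good as soon as 2|K| + |S| + |N| ≤ n.
-- Two admissible sets are used.  P₁ = V ∖ (S ∪ N) has |P₁| = n − |S| − |N|
-- < n, so D₁ = D[P₁] is good by minimality, with sources S₁ and N₁ =
-- N⁺_{D₁}(S₁).  If |S₁| ≤ |N₁| its bound gives 2|K₁| ≤ |P₁| directly.
-- Otherwise take P₂ = P₁ ∖ S₁: every source of D₂ = D[P₂] lies in N₁, so the
-- bound for D₂ gives 2|K₂| ≤ |P₂| + |N₁| ≤ |P₂| + |S₁| = |P₁|.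
-- Either way D would be good.

open import Defs
open import Data.Nat using (zero; suc; _+_; _*_; _∸_; _≤_; _<_; z≤n; _≤?_)
open import Data.Nat.Properties
  using ( +-comm; +-suc; +-identityʳ; +-monoˡ-≤; +-monoʳ-≤; *-monoʳ-≤; +-cancelʳ-≤
        ; ≤-reflexive; ≤-trans; ≤-<-trans; m≤m+n; m<n+m; n≤0⇒n≡0; ≰⇒≥; <⇒≱
        ; m+[n∸m]≡n; m∸n+n≡m; module ≤-Reasoning )
open import Data.Nat.Solver using (module +-*-Solver)
open import Data.Bool using (Bool; true; false; not; _∧_; T)
open import Data.Bool.Properties using (¬-not; T-≡; T-∧) renaming (_≟_ to _≟ᵇ_)
open import Data.Fin using (Fin; zero; suc)
open import Data.Fin.Properties using (all?; any?; ¬∀⟶∃¬)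
open import Data.Fin.Subset using (Subset; _∈_; _∉_; _⊆_; ∣_∣; _∪_; _∩_; ∁; ⊥; inside; outside)
open import Data.Fin.Subset.Properties
  using ( _∈?_; p⊆p∪q; q⊆p∪q; x∈p∪q⁻; x∈p∩q⁻; x∉p⇒x∈∁p; x∈∁p⇒x∉p; x∉∁p⇒x∈p
        ; p⊆q⇒∣p∣≤∣q∣; ∣⊥∣≡0; ∣∁p∣≡n∸∣p∣; ∣p∣≤n; x∈p⇒∣p-x∣<∣p∣ )
open import Data.Vec using (_∷_; []; tabulate; here; there)
open import Data.Vec.Properties using (lookup∘tabulate; []=⇒lookup; lookup⇒[]=)
open import Data.Product using (∃; _×_; _,_; proj₁)
open import Data.Sum using (inj₁; inj₂; [_,_]′)
open import Function using (_∘_)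
open import Function.Bundles using (Equivalence)
open import Relation.Nullary using (¬_; yes; no; contradiction)
open import Relation.Nullary.Decidable
  using (⌊_⌋; toWitness; fromWitness; toWitnessFalse; fromWitnessFalse)
open import Relation.Unary using (Pred; Decidable)
open import Relation.Binary.PropositionalEquality
  using (_≡_; refl; sym; trans; cong; subst; subst₂; module ≡-Reasoning)

∈-tabulate⁺ : ∀ {n} {f : Fin n → Bool} {x} → T (f x) → x ∈ tabulate f
∈-tabulate⁺ {f = f} {x} fx =
  lookup⇒[]= x (tabulate f) (trans (lookup∘tabulate f x) (Equivalence.to T-≡ fx))

∈-tabulate⁻ : ∀ {n} {f : Fin n → Bool} {x} → x ∈ tabulate f → T (f x)
∈-tabulate⁻ {f = f} {x} x∈ =
  Equivalence.from T-≡ (trans (sym (lookup∘tabulate f x)) ([]=⇒lookup x∈))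

select : ∀ {n p} {P : Pred (Fin n) p} → Decidable P → Subset n
select P? = tabulate (λ x → ⌊ P? x ⌋)

∈-select⁺ : ∀ {n p} {P : Pred (Fin n) p} (P? : Decidable P) {x} → P x → x ∈ select P?
∈-select⁺ P? px = ∈-tabulate⁺ (fromWitness px)

∈-select⁻ : ∀ {n p} {P : Pred (Fin n) p} (P? : Decidable P) {x} → x ∈ select P? → P x
∈-select⁻ P? x∈ = toWitness (∈-tabulate⁻ x∈)

∣p∪q∣+∣p∩q∣≡∣p∣+∣q∣ : ∀ {n} (p q : Subset n) → ∣ p ∪ q ∣ + ∣ p ∩ q ∣ ≡ ∣ p ∣ + ∣ q ∣
∣p∪q∣+∣p∩q∣≡∣p∣+∣q∣ []             []             = refl
∣p∪q∣+∣p∩q∣≡∣p∣+∣q∣ (inside  ∷ p) (inside  ∷ q) = cong suc (begin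
  ∣ p ∪ q ∣ + suc ∣ p ∩ q ∣   ≡⟨ +-suc ∣ p ∪ q ∣ ∣ p ∩ q ∣ ⟩
  suc (∣ p ∪ q ∣ + ∣ p ∩ q ∣) ≡⟨ cong suc (∣p∪q∣+∣p∩q∣≡∣p∣+∣q∣ p q) ⟩
  suc (∣ p ∣ + ∣ q ∣)         ≡⟨ +-suc ∣ p ∣ ∣ q ∣ ⟨
  ∣ p ∣ + suc ∣ q ∣           ∎)
  where open ≡-Reasoning
∣p∪q∣+∣p∩q∣≡∣p∣+∣q∣ (inside  ∷ p) (outside ∷ q) = cong suc (∣p∪q∣+∣p∩q∣≡∣p∣+∣q∣ p q)
∣p∪q∣+∣p∩q∣≡∣p∣+∣q∣ (outside ∷ p) (inside  ∷ q) =
  trans (cong suc (∣p∪q∣+∣p∩q∣≡∣p∣+∣q∣ p q)) (sym (+-suc ∣ p ∣ ∣ q ∣))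
∣p∪q∣+∣p∩q∣≡∣p∣+∣q∣ (outside ∷ p) (outside ∷ q) = ∣p∪q∣+∣p∩q∣≡∣p∣+∣q∣ p q

∣p∪q∣≤∣p∣+∣q∣ : ∀ {n} (p q : Subset n) → ∣ p ∪ q ∣ ≤ ∣ p ∣ + ∣ q ∣
∣p∪q∣≤∣p∣+∣q∣ p q = ≤-trans (m≤m+n ∣ p ∪ q ∣ ∣ p ∩ q ∣) (≤-reflexive (∣p∪q∣+∣p∩q∣≡∣p∣+∣q∣ p q))

disjoint-∣p∪q∣≡∣p∣+∣q∣ : ∀ {n} (p q : Subset n) → (∀ {x} → x ∈ p → x ∉ q) →
  ∣ p ∪ q ∣ ≡ ∣ p ∣ + ∣ q ∣
disjoint-∣p∪q∣≡∣p∣+∣q∣ {n} p q disjoint = begin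
  ∣ p ∪ q ∣                 ≡⟨ +-identityʳ ∣ p ∪ q ∣ ⟨
  ∣ p ∪ q ∣ + 0             ≡⟨ cong (∣ p ∪ q ∣ +_) ∣p∩q∣≡0 ⟨
  ∣ p ∪ q ∣ + ∣ p ∩ q ∣     ≡⟨ ∣p∪q∣+∣p∩q∣≡∣p∣+∣q∣ p q ⟩
  ∣ p ∣ + ∣ q ∣             ∎
  where
  open ≡-Reasoning
  p∩q⊆⊥ : p ∩ q ⊆ ⊥
  p∩q⊆⊥ x∈p∩q with x∈p∩q⁻ p q x∈p∩q
  ... | x∈p , x∈q = contradiction x∈q (disjoint x∈p)
  ∣p∩q∣≡0 : ∣ p ∩ q ∣ ≡ 0
  ∣p∩q∣≡0 = n≤0⇒n≡0 (≤-trans (p⊆q⇒∣p∣≤∣q∣ p∩q⊆⊥) (≤-reflexive (∣⊥∣≡0 n)))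

enum : ∀ {n} (P : Subset n) → Fin ∣ P ∣ → Fin n
enum (inside  ∷ P) zero    = zero
enum (inside  ∷ P) (suc i) = suc (enum P i)
enum (outside ∷ P) i       = suc (enum P i)

enum-∈ : ∀ {n} (P : Subset n) i → enum P i ∈ P
enum-∈ (inside  ∷ P) zero    = here
enum-∈ (inside  ∷ P) (suc i) = there (enum-∈ P i)
enum-∈ (outside ∷ P) i       = there (enum-∈ P i)

enum-onto : ∀ {n} (P : Subset n) {x} → x ∈ P → ∃ λ i → enum P i ≡ x
enum-onto (inside  ∷ P) here = zero , refl
enum-onto (inside  ∷ P) (there x∈P) with enum-onto P x∈P
... | i , refl = suc i , refl
enum-onto (outside ∷ P) (there x∈P) with enum-onto P x∈P
... | i , refl = i , refl

image : ∀ {n} (P : Subset n) → Subset ∣ P ∣ → Subset n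
image []            []      = []
image (inside  ∷ P) (s ∷ Q) = s ∷ image P Q
image (outside ∷ P) Q       = outside ∷ image P Q

∈-image⁺ : ∀ {n} (P : Subset n) {Q i} → i ∈ Q → enum P i ∈ image P Q
∈-image⁺ (inside  ∷ P) {_ ∷ Q} here          = here
∈-image⁺ (inside  ∷ P) {_ ∷ Q} (there i∈Q)   = there (∈-image⁺ P i∈Q)
∈-image⁺ (outside ∷ P) i∈Q                   = there (∈-image⁺ P i∈Q)

∈-image⁻ : ∀ {n} (P : Subset n) {Q x} → x ∈ image P Q → ∃ λ i → i ∈ Q × enum P i ≡ x
∈-image⁻ (inside  ∷ P) {_ ∷ Q} here = zero , here , refl
∈-image⁻ (inside  ∷ P) {_ ∷ Q} (there x∈) with ∈-image⁻ P x∈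
... | i , i∈Q , refl = suc i , there i∈Q , refl
∈-image⁻ (outside ∷ P) (there x∈) with ∈-image⁻ P x∈
... | i , i∈Q , refl = i , i∈Q , refl

∣image∣ : ∀ {n} (P : Subset n) Q → ∣ image P Q ∣ ≡ ∣ Q ∣
∣image∣ []            []            = refl
∣image∣ (inside  ∷ P) (inside  ∷ Q) = cong suc (∣image∣ P Q)
∣image∣ (inside  ∷ P) (outside ∷ Q) = ∣image∣ P Q
∣image∣ (outside ∷ P) Q             = ∣image∣ P Q

module _ {n} (D : Digraph n) where

  isSource? : Decidable (IsSource D)
  isSource? x = all? (λ y → arc D y x ≟ᵇ false)

  ∈-sources⁺ : ∀ {x} → IsSource D x → x ∈ sources D
  ∈-sources⁺ = ∈-select⁺ isSource?

  ∈-sources⁻ : ∀ {x} → x ∈ sources D → IsSource D x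
  ∈-sources⁻ = ∈-select⁻ isSource?

  arc-head-not-source : ∀ {x y} → Arc D x y → ¬ IsSource D y
  arc-head-not-source {x} xy y-src with trans (sym xy) (y-src x)
  ... | ()

  in-neighbour : ∀ {y} → ¬ IsSource D y → ∃ λ x → Arc D x y
  in-neighbour {y} ¬src with ¬∀⟶∃¬ n _ (λ x → arc D x y ≟ᵇ false) ¬src
  ... | x , xy≢false = x , ¬-not xy≢false

  private
    source-arc? : (y : Fin n) → Decidable (λ x → (⌊ isSource? x ⌋ ∧ arc D x y) ≡ true)
    source-arc? y x = (⌊ isSource? x ⌋ ∧ arc D x y) ≟ᵇ true

  ∈-N⁺S⁺ : ∀ {x y} → IsSource D x → Arc D x y → y ∈ outNbhdSources D
  ∈-N⁺S⁺ {x} {y} x-src xy = ∈-tabulate⁺ (Equivalence.from (T-∧ {not ⌊ isSource? y ⌋})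
    ( fromWitnessFalse (arc-head-not-source xy)
    , fromWitness (x , Equivalence.to T-≡ (Equivalence.from (T-∧ {⌊ isSource? x ⌋})
        (fromWitness x-src , Equivalence.from T-≡ xy)))))

  ∈-N⁺S⁻ : ∀ {y} → y ∈ outNbhdSources D →
    ¬ IsSource D y × ∃ λ x → IsSource D x × Arc D x y
  ∈-N⁺S⁻ {y} y∈ with Equivalence.to (T-∧ {not ⌊ isSource? y ⌋}) (∈-tabulate⁻ y∈)
  ... | ¬src , some-source with toWitness {a? = any? (source-arc? y)} some-source
  ...   | x , src∧xy with Equivalence.to (T-∧ {⌊ isSource? x ⌋}) (Equivalence.from T-≡ src∧xy)
  ...     | src , xy = toWitnessFalse ¬src , x , toWitness src , Equivalence.to T-≡ xy

induced : ∀ {n} → Digraph n → (P : Subset n) → Digraph ∣ P ∣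
induced D P = record
  { arc      = λ i j → arc D (enum P i) (enum P j)
  ; loopless = λ i → loopless D (enum P i)
  }

dist≤2-mono : ∀ {n} (D : Digraph n) {K L : Subset n} → K ⊆ L →
  ∀ {v} → DistAtMost2 D K v → DistAtMost2 D L v
dist≤2-mono D K⊆L (x , x∈K , path) = x , K⊆L x∈K , path

module _ {n} (D : Digraph n) (P : Subset n) {K : Subset ∣ P ∣} where

  image-independent : Independent (induced D P) K → Independent D (image P K)
  image-independent indep x y x∈ y∈ with ∈-image⁻ P x∈ | ∈-image⁻ P y∈
  ... | i , i∈K , refl | j , j∈K , refl = indep i j i∈K j∈K

  image-dist≤2 : ∀ {i} → DistAtMost2 (induced D P) K i → DistAtMost2 D (image P K) (enum P i)
  image-dist≤2 (j , j∈K , inj₁ ji)             = enum P j , ∈-image⁺ P j∈K , inj₁ ji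
  image-dist≤2 (j , j∈K , inj₂ (k , jk , ki)) = enum P j , ∈-image⁺ P j∈K , inj₂ (enum P k , jk , ki)

size-bound : ∀ {k s k′ ν n} → k ≤ s + k′ → 2 * k′ + (s + ν) ≤ n → 2 * k + ν ≤ n + s
size-bound {k} {s} {k′} {ν} {n} k≤s+k′ small = begin
  2 * k + ν                ≤⟨ +-monoˡ-≤ ν (*-monoʳ-≤ 2 k≤s+k′) ⟩
  2 * (s + k′) + ν         ≡⟨ rearrange s k′ ν ⟩
  s + (2 * k′ + (s + ν))   ≤⟨ +-monoʳ-≤ s small ⟩
  s + n                    ≡⟨ +-comm s n ⟩
  n + s                    ∎
  where
  open ≤-Reasoning
  open +-*-Solver
  rearrange : ∀ s k′ ν → 2 * (s + k′) + ν ≡ s + (2 * k′ + (s + ν))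
  rearrange = solve 3 (λ s k′ ν → con 2 :* (s :+ k′) :+ ν := s :+ (con 2 :* k′ :+ (s :+ ν))) refl

module Extension {n} (D : Digraph n) where

  S N : Subset n
  S = sources D
  N = outNbhdSources D

  -- A vertex set P from which a quasi-kernel of D[P] extends, by adding S,
  -- to a quasi-kernel of D: P avoids N⁺(S), and every vertex outside
  -- S ∪ N⁺(S) ∪ P is within distance 2 of S.
  record Admissible (P : Subset n) : Set where
    field
      avoids : ∀ {v} → v ∈ P → v ∉ N
      covers : ∀ {v} → v ∉ S → v ∉ N → v ∉ P → DistAtMost2 D S v

  module _ {P : Subset n} (adm : Admissible P) {K : Subset ∣ P ∣} where
    open Admissible adm

    -- No arc enters a source, and an arc from a source to P would put its
    -- head in N, which P avoids.
    extend-independent : Independent (induced D P) K → Independent D (S ∪ image P K)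
    extend-independent indep x y x∈ y∈ xy
      with x∈p∪q⁻ S (image P K) x∈ | x∈p∪q⁻ S (image P K) y∈
    ... | _        | inj₁ y∈S = arc-head-not-source D xy (∈-sources⁻ D y∈S)
    ... | inj₁ x∈S | inj₂ y∈I with ∈-image⁻ P y∈I
    ...   | j , _ , refl = avoids (enum-∈ P j) (∈-N⁺S⁺ D (∈-sources⁻ D x∈S) xy)
    extend-independent indep x y x∈ y∈ xy | inj₂ x∈I | inj₂ y∈I =
      image-independent D P indep x y x∈I y∈I xy

    -- A vertex outside S ∪ K is reached from S in one step if it is in N,
    -- from K via D[P] if it is in P, and by admissibility otherwise.
    extend-dominating : (∀ i → i ∉ K → DistAtMost2 (induced D P) K i) →
      ∀ v → v ∉ S ∪ image P K → DistAtMost2 D (S ∪ image P K) v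
    extend-dominating dom v v∉ with v ∈? N | v ∈? P
    ... | yes v∈N | _ with ∈-N⁺S⁻ D v∈N
    ...   | _ , x , x-src , xv = x , p⊆p∪q (image P K) (∈-sources⁺ D x-src) , inj₁ xv
    extend-dominating dom v v∉ | no v∉N | yes v∈P with enum-onto P v∈P
    ... | i , refl = dist≤2-mono D (q⊆p∪q S (image P K))
                       (image-dist≤2 D P (dom i (v∉ ∘ q⊆p∪q S (image P K) ∘ ∈-image⁺ P)))
    extend-dominating dom v v∉ | no v∉N | no v∉P =
      dist≤2-mono D (p⊆p∪q (image P K)) (covers (v∉ ∘ p⊆p∪q (image P K)) v∉N v∉P)

    extend-quasi-kernel : IsQuasiKernel (induced D P) K → IsQuasiKernel D (S ∪ image P K)
    extend-quasi-kernel (indep , dom) = extend-independent indep , extend-dominating dom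

    extend-good : IsQuasiKernel (induced D P) K → 2 * ∣ K ∣ + (∣ S ∣ + ∣ N ∣) ≤ n → Good D
    extend-good qk small = S ∪ image P K , extend-quasi-kernel qk , size-bound ∣K⁺∣≤ small
      where
      ∣K⁺∣≤ : ∣ S ∪ image P K ∣ ≤ ∣ S ∣ + ∣ K ∣
      ∣K⁺∣≤ = ≤-trans (∣p∪q∣≤∣p∣+∣q∣ S (image P K)) (≤-reflexive (cong (∣ S ∣ +_) (∣image∣ P K)))

module Reduction {n} (D : Digraph n) where
  open Extension D

  P₁ : Subset n
  P₁ = ∁ (S ∪ N)

  D₁ : Digraph ∣ P₁ ∣
  D₁ = induced D P₁

  S₁ N₁ : Subset ∣ P₁ ∣
  S₁ = sources D₁
  N₁ = outNbhdSources D₁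

  P₂ : Subset n
  P₂ = image P₁ (∁ S₁)

  D₂ : Digraph ∣ P₂ ∣
  D₂ = induced D P₂

  S∩N≡∅ : ∀ {v} → v ∈ S → v ∉ N
  S∩N≡∅ v∈S v∈N = proj₁ (∈-N⁺S⁻ D v∈N) (∈-sources⁻ D v∈S)

  ∈P₁ : ∀ {v} → v ∉ S → v ∉ N → v ∈ P₁
  ∈P₁ v∉S v∉N = x∉p⇒x∈∁p ([ v∉S , v∉N ]′ ∘ x∈p∪q⁻ S N)

  -- Nothing lies outside S ∪ N ∪ P₁, so P₁ is trivially admissible.
  P₁-admissible : Admissible P₁
  P₁-admissible = record
    { avoids = λ v∈P₁ v∈N → x∈∁p⇒x∉p v∈P₁ (q⊆p∪q S N v∈N)
    ; covers = λ v∉S v∉N v∉P₁ → contradiction (∈P₁ v∉S v∉N) v∉P₁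
    }

  ∣S∣+∣N∣+∣P₁∣≡n : ∣ S ∣ + ∣ N ∣ + ∣ P₁ ∣ ≡ n
  ∣S∣+∣N∣+∣P₁∣≡n = begin
    ∣ S ∣ + ∣ N ∣ + ∣ P₁ ∣               ≡⟨ cong (_+ ∣ P₁ ∣) (disjoint-∣p∪q∣≡∣p∣+∣q∣ S N S∩N≡∅) ⟨
    ∣ S ∪ N ∣ + ∣ ∁ (S ∪ N) ∣             ≡⟨ cong (∣ S ∪ N ∣ +_) (∣∁p∣≡n∸∣p∣ (S ∪ N)) ⟩
    ∣ S ∪ N ∣ + (n ∸ ∣ S ∪ N ∣)           ≡⟨ m+[n∸m]≡n (∣p∣≤n (S ∪ N)) ⟩
    n                                     ∎
    where open ≡-Reasoning

  -- P₂ ⊆ P₁ avoids N.  A vertex v outside S ∪ N ∪ P₂ lies in P₁ and is a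
  -- source of D₁; an in-neighbour of v is neither in S (else v ∈ N) nor in
  -- P₁, so it lies in N and v is at distance 2 from S.
  P₂-admissible : Admissible P₂
  P₂-admissible = record { avoids = avoids₂ ; covers = covers₂ }
    where
    avoids₂ : ∀ {v} → v ∈ P₂ → v ∉ N
    avoids₂ v∈P₂ with ∈-image⁻ P₁ v∈P₂
    ... | j , _ , refl = Admissible.avoids P₁-admissible (enum-∈ P₁ j)

    covers₂ : ∀ {v} → v ∉ S → v ∉ N → v ∉ P₂ → DistAtMost2 D S v
    covers₂ v∉S v∉N v∉P₂ with enum-onto P₁ (∈P₁ v∉S v∉N)
    ... | j , refl with in-neighbour D (v∉S ∘ ∈-sources⁺ D)
    ...   | y , yv with y ∈? S | y ∈? N
    ...     | yes y∈S | _       = contradiction (∈-N⁺S⁺ D (∈-sources⁻ D y∈S) yv) v∉N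
    ...     | no _    | yes y∈N with ∈-N⁺S⁻ D y∈N
    ...       | _ , x , x-src , xy = x , ∈-sources⁺ D x-src , inj₂ (y , xy , yv)
    covers₂ v∉S v∉N v∉P₂ | j , refl | y , yv | no y∉S | no y∉N with enum-onto P₁ (∈P₁ y∉S y∉N)
    ... | k , refl = contradiction yv (λ kj → arc-head-not-source D₁ kj j-source)
      where
      j-source : IsSource D₁ j
      j-source = ∈-sources⁻ D₁ (x∉∁p⇒x∈p (v∉P₂ ∘ ∈-image⁺ P₁))

  ∣P₂∣+∣S₁∣≡∣P₁∣ : ∣ P₂ ∣ + ∣ S₁ ∣ ≡ ∣ P₁ ∣
  ∣P₂∣+∣S₁∣≡∣P₁∣ = begin
    ∣ P₂ ∣ + ∣ S₁ ∣               ≡⟨ cong (_+ ∣ S₁ ∣) (∣image∣ P₁ (∁ S₁)) ⟩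
    ∣ ∁ S₁ ∣ + ∣ S₁ ∣             ≡⟨ cong (_+ ∣ S₁ ∣) (∣∁p∣≡n∸∣p∣ S₁) ⟩
    ∣ P₁ ∣ ∸ ∣ S₁ ∣ + ∣ S₁ ∣      ≡⟨ m∸n+n≡m (∣p∣≤n S₁) ⟩
    ∣ P₁ ∣                        ∎
    where open ≡-Reasoning

  -- A source of D₂ lies, as a vertex of D₁, in N₁: it is no source of D₁,
  -- and an in-neighbour of it in D₁ outside S₁ would lie in P₂.
  sources₂⊆N₁ : ∀ {i} → i ∈ sources D₂ → ∃ λ j → j ∈ N₁ × enum P₁ j ≡ enum P₂ i
  sources₂⊆N₁ {i} i∈S₂ with ∈-image⁻ P₁ (enum-∈ P₂ i)
  ... | j , j∉S₁ , j≡i with in-neighbour D₁ (x∈∁p⇒x∉p j∉S₁ ∘ ∈-sources⁺ D₁)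
  ...   | k , kj with k ∈? S₁
  ...     | yes k∈S₁ = j , ∈-N⁺S⁺ D₁ (∈-sources⁻ D₁ k∈S₁) kj , j≡i
  ...     | no k∉S₁ with enum-onto P₂ (∈-image⁺ P₁ (x∉p⇒x∈∁p k∉S₁))
  ...       | i′ , i′≡k =
    contradiction (∈-sources⁻ D₂ i∈S₂) (arc-head-not-source D₂ (subst₂ (Arc D) (sym i′≡k) j≡i kj))

  ∣S₂∣≤∣N₁∣ : ∣ sources D₂ ∣ ≤ ∣ N₁ ∣
  ∣S₂∣≤∣N₁∣ = begin
    ∣ sources D₂ ∣               ≡⟨ ∣image∣ P₂ (sources D₂) ⟨
    ∣ image P₂ (sources D₂) ∣    ≤⟨ p⊆q⇒∣p∣≤∣q∣ S₂⊆N₁ ⟩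
    ∣ image P₁ N₁ ∣              ≡⟨ ∣image∣ P₁ N₁ ⟩
    ∣ N₁ ∣                       ∎
    where
    open ≤-Reasoning
    S₂⊆N₁ : image P₂ (sources D₂) ⊆ image P₁ N₁
    S₂⊆N₁ v∈ with ∈-image⁻ P₂ v∈
    ... | i , i∈S₂ , refl with sources₂⊆N₁ i∈S₂
    ...   | j , j∈N₁ , j≡i = subst (_∈ image P₁ N₁) j≡i (∈-image⁺ P₁ j∈N₁)

  ∣P₂∣≤∣P₁∣ : ∣ P₂ ∣ ≤ ∣ P₁ ∣
  ∣P₂∣≤∣P₁∣ = ≤-trans (m≤m+n ∣ P₂ ∣ ∣ S₁ ∣) (≤-reflexive ∣P₂∣+∣S₁∣≡∣P₁∣)

  ∣P₁∣<n : ∀ {x} → IsSource D x → ∣ P₁ ∣ < n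
  ∣P₁∣<n x-src = begin-strict
    ∣ P₁ ∣                   <⟨ m<n+m ∣ P₁ ∣ (≤-<-trans z≤n (x∈p⇒∣p-x∣<∣p∣ (∈-sources⁺ D x-src))) ⟩
    ∣ S ∣ + ∣ P₁ ∣           ≤⟨ +-monoˡ-≤ ∣ P₁ ∣ (m≤m+n ∣ S ∣ ∣ N ∣) ⟩
    ∣ S ∣ + ∣ N ∣ + ∣ P₁ ∣   ≡⟨ ∣S∣+∣N∣+∣P₁∣≡n ⟩
    n                        ∎
    where open ≤-Reasoning

  small-enough : ∀ k → 2 * k ≤ ∣ P₁ ∣ → 2 * k + (∣ S ∣ + ∣ N ∣) ≤ n
  small-enough k 2k≤∣P₁∣ = begin
    2 * k + (∣ S ∣ + ∣ N ∣)     ≤⟨ +-monoˡ-≤ (∣ S ∣ + ∣ N ∣) 2k≤∣P₁∣ ⟩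
    ∣ P₁ ∣ + (∣ S ∣ + ∣ N ∣)    ≡⟨ +-comm ∣ P₁ ∣ (∣ S ∣ + ∣ N ∣) ⟩
    ∣ S ∣ + ∣ N ∣ + ∣ P₁ ∣      ≡⟨ ∣S∣+∣N∣+∣P₁∣≡n ⟩
    n                           ∎
    where open ≤-Reasoning

  good-via-D₁ : ∣ S₁ ∣ ≤ ∣ N₁ ∣ → Good D₁ → Good D
  good-via-D₁ S₁≤N₁ (K , qk , bound) = extend-good P₁-admissible qk (small-enough ∣ K ∣ 2∣K∣≤∣P₁∣)
    where
    2∣K∣≤∣P₁∣ : 2 * ∣ K ∣ ≤ ∣ P₁ ∣
    2∣K∣≤∣P₁∣ = +-cancelʳ-≤ (∣ N₁ ∣) (2 * ∣ K ∣) (∣ P₁ ∣) (≤-trans bound (+-monoʳ-≤ ∣ P₁ ∣ S₁≤N₁))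

  good-via-D₂ : ∣ N₁ ∣ ≤ ∣ S₁ ∣ → Good D₂ → Good D
  good-via-D₂ N₁≤S₁ (K , qk , bound) = extend-good P₂-admissible qk (small-enough ∣ K ∣ 2∣K∣≤∣P₁∣)
    where
    open ≤-Reasoning
    2∣K∣≤∣P₁∣ : 2 * ∣ K ∣ ≤ ∣ P₁ ∣
    2∣K∣≤∣P₁∣ = begin
      2 * ∣ K ∣                               ≤⟨ m≤m+n (2 * ∣ K ∣) ∣ outNbhdSources D₂ ∣ ⟩
      2 * ∣ K ∣ + ∣ outNbhdSources D₂ ∣       ≤⟨ bound ⟩
      ∣ P₂ ∣ + ∣ sources D₂ ∣                 ≤⟨ +-monoʳ-≤ ∣ P₂ ∣ (≤-trans ∣S₂∣≤∣N₁∣ N₁≤S₁) ⟩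
      ∣ P₂ ∣ + ∣ S₁ ∣                         ≡⟨ ∣P₂∣+∣S₁∣≡∣P₁∣ ⟩
      ∣ P₁ ∣                                  ∎

  source-not-bad : ∀ {x} → IsSource D x →
    (∀ {m} (H : Digraph m) → m < n → ¬ ¬ Good H) → ¬ ¬ Good D
  source-not-bad x-src smaller-not-bad not-good with ∣ S₁ ∣ ≤? ∣ N₁ ∣
  ... | yes S₁≤N₁ =
    smaller-not-bad D₁ (∣P₁∣<n x-src) (not-good ∘ good-via-D₁ S₁≤N₁)
  ... | no S₁≰N₁ =
    smaller-not-bad D₂ (≤-<-trans ∣P₂∣≤∣P₁∣ (∣P₁∣<n x-src)) (not-good ∘ good-via-D₂ (≰⇒≥ S₁≰N₁))

theorem3 : (∃ λ m → ∃ λ (D' : Digraph m) → ¬ Good D') →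
    ∀ n (D : Digraph n) → ¬ Good D →
    (∀ m (D' : Digraph m) → ¬ Good D' → n ≤ m) →
    ∀ x → ¬ IsSource D x
theorem3 _ n D not-good minimal x x-source =
  Reduction.source-not-bad D x-source smaller-not-bad not-good
  where
  smaller-not-bad : ∀ {m} (H : Digraph m) → m < n → ¬ ¬ Good H
  smaller-not-bad H m<n not-good-H = <⇒≱ m<n (minimal _ H not-good-H)
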